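{- Let $\ell\ge 0$ be an integer. Every $2$-connected planar graph $G$ of girth at least $5\ell+1$, minimum degree at least $2$ and maximum degree at least $3$ contains a suspended $k$-path for some $k\ge \ell+1$.
   Context: A suspended $k$-path in $G$ is a path with $k$ edges whose two endpoints are distinct and have degree at least $3$ in $G$ and whose inner vertices have degree exactly $2$ in $G$. -}

module Defs where

open import Data.Nat using (ℕ; zero; suc; _+_; _*_; _≤_; _<_; _≤ᵇ_; _<ᵇ_)
open import Data.Fin using (Fin; toℕ; fromℕ; inject₁) renaming (zero to fzero; suc to fsuc)
open import Data.Fin.Properties using () renaming (_≟_ to _≟ᶠ_)
open import Data.Bool using (Bool; true; false; _∧_; _∨_; not)
open import Data.List using (List; length; filterᵇ; allFin; upTo)
open import Data.Bool.ListAction using (any; all)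
open import Data.Product using (Σ; ∃; _×_; _,_; proj₁; proj₂)
open import Data.Unit using (⊤)
open import Relation.Binary.PropositionalEquality using (_≡_; _≢_)
open import Relation.Nullary.Decidable using (⌊_⌋)
open import Function.Definitions using (Injective)

record Graph : Set where
  field
    n      : ℕ
    adj    : Fin n → Fin n → Bool
    sym    : ∀ u v → adj u v ≡ adj v u
    irrefl : ∀ v → adj v v ≡ false
open Graph public

count : ∀ {m} → (Fin m → Bool) → ℕ
count {m} p = length (filterᵇ p (allFin m))

deg : (G : Graph) → Fin (n G) → ℕ
deg G v = count (adj G v)

sumFin : ∀ {m} → (Fin m → ℕ) → ℕ
sumFin {zero} f = 0
sumFin {suc m} f = f fzero + sumFin (λ i → f (fsuc i))

edgeCount : Graph → ℕ
edgeCount G = sumFin {n G} (λ u → count {n G} (λ v → (toℕ u <ᵇ toℕ v) ∧ adj G u v))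

data WalkIn (G : Graph) (P : Fin (n G) → Set) : Fin (n G) → Fin (n G) → Set where
  here : ∀ {u} → P u → WalkIn G P u u
  step : ∀ {u v w} → P u → adj G u v ≡ true → WalkIn G P v w → WalkIn G P u w

Connected : Graph → Set
Connected G = ∀ u w → WalkIn G (λ _ → ⊤) u w

TwoConnected : Graph → Set
TwoConnected G =
  (3 ≤ n G) × Connected G ×
  (∀ x u w → u ≢ x → w ≢ x → WalkIn G (λ y → y ≢ x) u w)

IsCycle : (G : Graph) (m : ℕ) → (Fin (suc m) → Fin (n G)) → Set
IsCycle G m c =
  (2 ≤ m) × Injective _≡_ _≡_ c ×
  (∀ (i : Fin m) → adj G (c (inject₁ i)) (c (fsuc i)) ≡ true) ×
  (adj G (c (fromℕ m)) (c fzero) ≡ true)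

GirthAtLeast : Graph → ℕ → Set
GirthAtLeast G g = ∀ m c → IsCycle G m c → g ≤ suc m

SuspendedPath : (G : Graph) (k : ℕ) → (Fin (suc k) → Fin (n G)) → Set
SuspendedPath G k p =
  Injective _≡_ _≡_ p ×
  (∀ (i : Fin k) → adj G (p (inject₁ i)) (p (fsuc i)) ≡ true) ×
  (p fzero ≢ p (fromℕ k)) ×
  (3 ≤ deg G (p fzero)) × (3 ≤ deg G (p (fromℕ k))) ×
  (∀ (j : Fin (suc k)) → 0 < toℕ j → toℕ j < k → deg G (p j) ≡ 2)

-- Planarity via combinatorial embeddings (rotation systems) of Euler genus 0

iter : ∀ {A : Set} → (A → A) → ℕ → A → A
iter f zero x = x
iter f (suc k) x = f (iter f k x)

-- rot v u = successor of the neighbour u in the cyclic order around v;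
-- it must be a single cyclic permutation of the neighbourhood of v
record RotationSystem (G : Graph) : Set where
  field
    rot    : Fin (n G) → Fin (n G) → Fin (n G)
    closed : ∀ v u → adj G v u ≡ true → adj G v (rot v u) ≡ true
    cyclic : ∀ v u w → adj G v u ≡ true → adj G v w ≡ true →
             ∃ λ i → iter (rot v) i u ≡ w
open RotationSystem public

module _ (G : Graph) (ρ : RotationSystem G) where
  private
    N = n G
    Dart = Fin N × Fin N

  -- face-tracing permutation on darts (u , v)
  faceStep : Dart → Dart
  faceStep (u , v) = v , rot ρ v u

  dartKey : Dart → ℕ
  dartKey (u , v) = toℕ u * N + toℕ v

  -- d is a dart which has the least key in its faceStep-orbit (orbits have size ≤ N*N)
  isFaceRep : Dart → Bool
  isFaceRep d = adj G (proj₁ d) (proj₂ d) ∧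
                all (λ i → dartKey d ≤ᵇ dartKey (iter faceStep i d)) (upTo (N * N))

  isolatedCount : ℕ
  isolatedCount = count {N} (λ v → not (any (adj G v) (allFin N)))

  -- faces: one per faceStep-orbit of darts, plus one per isolated vertex
  faceCount : ℕ
  faceCount = sumFin {N} (λ u → count {N} (λ v → isFaceRep (u , v))) + isolatedCount

reach : (G : Graph) → ℕ → Fin (n G) → Fin (n G) → Bool
reach G zero u v = ⌊ u ≟ᶠ v ⌋
reach G (suc k) u v = reach G k u v ∨ any (λ w → reach G k u w ∧ adj G w v) (allFin (n G))

componentCount : Graph → ℕ
componentCount G =
  count {n G} (λ v → not (any (λ u → (toℕ u <ᵇ toℕ v) ∧ reach G (n G) u v) (allFin (n G))))

-- planar: has a rotation system satisfying Euler's formula V - E + F = 2c (genus 0)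
Planar : Graph → Set
Planar G = Σ (RotationSystem G) λ ρ →
  n G + faceCount G ρ ≡ edgeCount G + 2 * componentCount G

-- Suppose every suspended path has at most ℓ edges.  Walking along a face of the plane
-- embedding from a branch vertex (degree ≥ 3), the vertices passed up to the next branch
-- vertex have degree 2 and form a suspended path (2-connectivity prevents it from closing
-- up), so consecutive branch vertices on a face are at most ℓ steps apart; every face meets
-- a branch vertex because G is connected.  A face is a closed non-backtracking walk, hence
-- contains a cycle and has length at least 5ℓ + 1, so it passes at least six darts leaving
-- branch vertices.  Counting these darts B, 6F ≤ B ≤ 3 Σ deg − 6V ≤ 6E − 6V, which
-- contradicts Euler's formula V − E + F = 2c ≥ 2.

module Submission where

open import Defs hiding (sym)
import Algebra.Properties.Semiring.Sum as ∑
open import Data.Bool using (Bool; true; false; _∧_; not)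
import Data.Bool as Bool
open import Data.Bool.Properties using (∧-conicalˡ; ∧-conicalʳ; ∧-zeroʳ; ∧-identityʳ; T-≡)
open import Data.Bool.ListAction using (any)
open import Data.Empty using (⊥; ⊥-elim)
open import Data.Fin using (Fin; toℕ; fromℕ; fromℕ<; inject₁; combine)
  renaming (zero to fzero; suc to fsuc)
import Data.Fin.Properties as Finₚ
open import Data.List using ([]; _∷_; filterᵇ; tabulate; allFin; upTo)
open import Data.List.Membership.Propositional using (lose)
open import Data.List.Membership.Propositional.Properties using (∈-allFin; ∈-upTo⁺)
open import Data.List.Relation.Unary.All using (lookup)
open import Data.List.Relation.Unary.All.Properties using (all⁺)
open import Data.List.Relation.Unary.Any.Properties using (any⁺)
open import Data.Nat hiding (_≟_)
open import Data.Nat.Properties hiding (_≟_)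
open import Data.Product using (Σ; ∃; _×_; _,_; proj₁; proj₂)
open import Data.Product.Properties using (≡-dec)
open import Data.Sum using (_⊎_; inj₁; inj₂; map₂; [_,_]′)
open import Function using (id; _∘_; _⇔_; mk⇔; Equivalence)
open import Function.Definitions using (Injective)
open import Relation.Binary.Definitions using (DecidableEquality; tri<; tri≈; tri>)
open import Relation.Binary.PropositionalEquality
open import Relation.Nullary using (¬_; Dec; yes; no; ¬?; _×-dec_; contradiction)
import Relation.Nullary.Decidable as Dec
open import Relation.Nullary.Decidable using (⌊_⌋; ⌊⌋-map′; isYes≗does; dec-true; dec-false; does-⇔)

open ∑ +-*-semiring using (sum; sum-cong-≗; ∑-comm; ∑-distrib-+; *-distribˡ-sum; sum-replicate-zero)

⌊⌋-true : ∀ {P : Set} (p? : Dec P) → P → ⌊ p? ⌋ ≡ true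
⌊⌋-true p? p = trans (isYes≗does p?) (dec-true p? p)

⌊⌋-false : ∀ {P : Set} (p? : Dec P) → ¬ P → ⌊ p? ⌋ ≡ false
⌊⌋-false p? ¬p = trans (isYes≗does p?) (dec-false p? ¬p)

⌊⌋-true⁻ : ∀ {P : Set} (p? : Dec P) → ⌊ p? ⌋ ≡ true → P
⌊⌋-true⁻ (yes p) _ = p

⌊⌋-⇔ : ∀ {P Q : Set} → P ⇔ Q → (p? : Dec P) (q? : Dec Q) → ⌊ p? ⌋ ≡ ⌊ q? ⌋
⌊⌋-⇔ P⇔Q p? q? = trans (isYes≗does p?) (trans (does-⇔ P⇔Q p? q?) (sym (isYes≗does q?)))

ind : Bool → ℕ
ind true  = 1
ind false = 0

sumFin≡sum : ∀ {m} (f : Fin m → ℕ) → sumFin f ≡ sum f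
sumFin≡sum {zero}  f = refl
sumFin≡sum {suc m} f = cong (f fzero +_) (sumFin≡sum (f ∘ fsuc))

count≡sum : ∀ {m} (p : Fin m → Bool) → count p ≡ sum (ind ∘ p)
count≡sum p = go p (λ i → i)
  where
  go : ∀ {m} {A : Set} (p : A → Bool) (f : Fin m → A) →
       Data.List.length (filterᵇ p (tabulate f)) ≡ sum (ind ∘ p ∘ f)
  go {zero}  p f = refl
  go {suc m} p f with p (f fzero)
  ... | true  = cong suc (go p (f ∘ fsuc))
  ... | false = go p (f ∘ fsuc)

sum-mono-≤ : ∀ {m} {f g : Fin m → ℕ} → (∀ i → f i ≤ g i) → sum f ≤ sum g
sum-mono-≤ {zero}  f≤g = z≤n
sum-mono-≤ {suc m} f≤g = +-mono-≤ (f≤g fzero) (sum-mono-≤ (f≤g ∘ fsuc))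

sum-const : ∀ m c → sum {m} (λ _ → c) ≡ m * c
sum-const zero    c = refl
sum-const (suc m) c = cong (c +_) (sum-const m c)

term≤sum : ∀ {m} (f : Fin m → ℕ) i → f i ≤ sum f
term≤sum f fzero    = m≤m+n (f fzero) _
term≤sum f (fsuc i) = ≤-trans (term≤sum (f ∘ fsuc) i) (m≤n+m _ (f fzero))

-- A finite type, presented through summation of ℕ-valued functions over it.
record Summation (A : Set) : Set₁ where
  field
    ∑          : (A → ℕ) → ℕ
    ∑-cong     : ∀ {f g} → (∀ x → f x ≡ g x) → ∑ f ≡ ∑ g
    ∑-mono-≤   : ∀ {f g} → (∀ x → f x ≤ g x) → ∑ f ≤ ∑ g
    ∑-zero     : ∑ (λ _ → 0) ≡ 0
    ∑-*ˡ       : ∀ c f → ∑ (λ x → c * f x) ≡ c * ∑ f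
    _≟_        : DecidableEquality A
    ∑-point    : ∀ a → ∑ (λ x → ind ⌊ x ≟ a ⌋) ≡ 1
    any?       : ∀ {P : A → Set} → (∀ x → Dec (P x)) → Dec (∃ P)
    ∑-sum-comm : ∀ {m} (f : A → Fin m → ℕ) → ∑ (λ x → sum (f x)) ≡ sum (λ i → ∑ (λ x → f x i))

finSummation : ∀ m → Summation (Fin m)
finSummation m = record
  { ∑ = sum ; ∑-cong = sum-cong-≗ ; ∑-mono-≤ = sum-mono-≤ ; ∑-zero = sum-replicate-zero m
  ; ∑-*ˡ = λ c f → sym (*-distribˡ-sum c f)
  ; _≟_ = Finₚ._≟_ ; ∑-point = point ; any? = Finₚ.any? ; ∑-sum-comm = ∑-comm }
  where
  point : ∀ {m} (a : Fin m) → sum (λ x → ind ⌊ x Finₚ.≟ a ⌋) ≡ 1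
  point {suc m} fzero    = cong suc (sum-replicate-zero m)
  point {suc m} (fsuc a) = trans (sum-cong-≗ {m} shift) (point a)
    where
    shift : ∀ x → ind ⌊ fsuc x Finₚ.≟ fsuc a ⌋ ≡ ind ⌊ x Finₚ.≟ a ⌋
    shift x = cong ind (⌊⌋-⇔ (mk⇔ Finₚ.suc-injective (cong fsuc)) (fsuc x Finₚ.≟ fsuc a) (x Finₚ.≟ a))

×-summation : ∀ {A B : Set} → Summation A → Summation B → Summation (A × B)
×-summation {A} {B} SA SB = record
  { ∑ = ∑×
  ; ∑-cong = λ f≗g → A.∑-cong (λ a → B.∑-cong (λ b → f≗g (a , b)))
  ; ∑-mono-≤ = λ f≤g → A.∑-mono-≤ (λ a → B.∑-mono-≤ (λ b → f≤g (a , b)))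
  ; ∑-zero = trans (A.∑-cong (λ _ → B.∑-zero)) A.∑-zero
  ; ∑-*ˡ = λ c f → trans (A.∑-cong (λ a → B.∑-*ˡ c (λ b → f (a , b)))) (A.∑-*ˡ c _)
  ; _≟_ = _≟×_
  ; ∑-point = point
  ; any? = λ P? → Dec.map′ (λ (a , b , p) → (a , b) , p) (λ ((a , b) , p) → a , b , p)
                           (A.any? (λ a → B.any? (λ b → P? (a , b))))
  ; ∑-sum-comm = λ f → trans (A.∑-cong (λ a → B.∑-sum-comm (λ b → f (a , b))))
                             (A.∑-sum-comm (λ a i → B.∑ (λ b → f (a , b) i)))
  }
  where
  module A = Summation SA
  module B = Summation SB
  ∑× : (A × B → ℕ) → ℕ
  ∑× f = A.∑ (λ a → B.∑ (λ b → f (a , b)))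
  _≟×_ : DecidableEquality (A × B)
  _≟×_ = ≡-dec A._≟_ B._≟_
  row : ∀ a b u → B.∑ (λ v → ind ⌊ (u , v) ≟× (a , b) ⌋) ≡ ind ⌊ u A.≟ a ⌋
  row a b u with u A.≟ a
  ... | yes refl = trans (B.∑-cong (λ v → cong ind (⌊⌋-map′ _ _ (v B.≟ b))))
                         (B.∑-point b)
  ... | no _ = B.∑-zero
  point : ∀ x → ∑× (λ y → ind ⌊ y ≟× x ⌋) ≡ 1
  point (a , b) = trans (A.∑-cong (row a b)) (A.∑-point a)

squareSummation : ∀ m → Summation (Fin m × Fin m)
squareSummation m = ×-summation (finSummation m) (finSummation m)

module Counting {A : Set} (S : Summation A) where
  open Summation S

  #_ : (A → Bool) → ℕ
  # p = ∑ (ind ∘ p)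

  #-none : ∀ p → (∀ x → p x ≡ false) → # p ≡ 0
  #-none p none = trans (∑-cong (cong ind ∘ none)) ∑-zero

  ∑-points : ∀ {k} (c : Fin k → A) → ∑ (λ x → sum (λ i → ind ⌊ x ≟ c i ⌋)) ≡ k
  ∑-points {k} c = begin
    ∑ (λ x → sum (λ i → ind ⌊ x ≟ c i ⌋)) ≡⟨ ∑-sum-comm (λ x i → ind ⌊ x ≟ c i ⌋) ⟩
    sum (λ i → ∑ (λ x → ind ⌊ x ≟ c i ⌋)) ≡⟨ sum-cong-≗ (∑-point ∘ c) ⟩
    sum {k} (λ _ → 1)                     ≡⟨ sum-const k 1 ⟩
    k * 1                                 ≡⟨ *-identityʳ k ⟩
    k                                     ∎
    where open ≡-Reasoning

  #-≤-cover : ∀ {k} p (c : Fin k → A) → (∀ x → p x ≡ true → ∃ λ i → x ≡ c i) → # p ≤ k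
  #-≤-cover {k} p c covered = ≤-trans (∑-mono-≤ hit) (≤-reflexive (∑-points c))
    where
    hit : ∀ x → ind (p x) ≤ sum (λ i → ind ⌊ x ≟ c i ⌋)
    hit x with p x in px
    ... | false = z≤n
    ... | true  with covered x px
    ...   | i , x≡cᵢ = ≤-trans (≤-reflexive (cong ind (sym (⌊⌋-true (x ≟ c i) x≡cᵢ))))
                                (term≤sum (λ i → ind ⌊ x ≟ c i ⌋) i)

  #-≤1 : ∀ p → (∀ x y → p x ≡ true → p y ≡ true → x ≡ y) → # p ≤ 1
  #-≤1 p unique with any? (λ x → p x Bool.≟ true)
  ... | yes (a , pa) = #-≤-cover p (λ _ → a) (λ x px → fzero , unique x a px pa)
  ... | no ∄ = ≤-trans (≤-reflexive (#-none p none)) z≤n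
    where
    none : ∀ x → p x ≡ false
    none x with p x in px
    ... | true  = contradiction (x , px) ∄
    ... | false = refl

  #-beyond-cover : ∀ {k} p (c : Fin k → A) → k < # p → ∃ λ x → p x ≡ true × (∀ i → x ≢ c i)
  #-beyond-cover p c k<#p with any? (λ x → (p x Bool.≟ true) ×-dec Finₚ.all? (λ i → ¬? (x ≟ c i)))
  ... | yes found = found
  ... | no ∄ = contradiction (#-≤-cover p c covered) (<⇒≱ k<#p)
    where
    covered : ∀ x → p x ≡ true → ∃ λ i → x ≡ c i
    covered x px with Finₚ.any? (λ i → x ≟ c i)
    ... | yes hit = hit
    ... | no miss = contradiction (x , px , λ i x≡cᵢ → miss (i , x≡cᵢ)) ∄

#-≥-injection : ∀ {A : Set} (S : Summation A) {k} (p : A → Bool) (c : Fin k → A) →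
                Injective _≡_ _≡_ c → (∀ i → p (c i) ≡ true) → k ≤ Counting.#_ S p
#-≥-injection S p c c-inj pc = ≤-trans (≤-reflexive (sym (∑-points c))) (∑-mono-≤ hits≤1)
  where
  open Summation S
  open Counting S
  module Fin# = Counting (finSummation _)
  hits≤1 : ∀ x → sum (λ i → ind ⌊ x ≟ c i ⌋) ≤ ind (p x)
  hits≤1 x with p x in px
  ... | true  = Fin#.#-≤1 (λ i → ⌊ x ≟ c i ⌋) λ i j x≡cᵢ x≡cⱼ →
                  c-inj (trans (sym (⌊⌋-true⁻ (x ≟ c i) x≡cᵢ)) (⌊⌋-true⁻ (x ≟ c j) x≡cⱼ))
  ... | false = ≤-reflexive (Fin#.#-none (λ i → ⌊ x ≟ c i ⌋) λ i →
                  ⌊⌋-false (x ≟ c i) λ { refl → contradiction (trans (sym px) (pc i)) λ () })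

triple : ∀ {A : Set} → A → A → A → Fin 3 → A
triple a b c fzero               = a
triple a b c (fsuc fzero)        = b
triple a b c (fsuc (fsuc fzero)) = c

triple-injective : ∀ {A : Set} {a b c : A} → a ≢ b → a ≢ c → b ≢ c → Injective _≡_ _≡_ (triple a b c)
triple-injective _ _ _ {fzero}             {fzero}               _ = refl
triple-injective _ _ _ {fsuc fzero}        {fsuc fzero}          _ = refl
triple-injective _ _ _ {fsuc (fsuc fzero)} {fsuc (fsuc fzero)}   _ = refl
triple-injective a≢b a≢c b≢c {fzero}       {fsuc fzero}          e = contradiction e a≢b
triple-injective a≢b a≢c b≢c {fzero}       {fsuc (fsuc fzero)}   e = contradiction e a≢c
triple-injective a≢b a≢c b≢c {fsuc fzero}  {fzero}               e = contradiction (sym e) a≢b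
triple-injective a≢b a≢c b≢c {fsuc fzero}  {fsuc (fsuc fzero)}   e = contradiction e b≢c
triple-injective a≢b a≢c b≢c {fsuc (fsuc fzero)} {fzero}         e = contradiction (sym e) a≢c
triple-injective a≢b a≢c b≢c {fsuc (fsuc fzero)} {fsuc fzero}    e = contradiction (sym e) b≢c

iter-suc : ∀ {A : Set} (f : A → A) k x → iter f k (f x) ≡ f (iter f k x)
iter-suc f zero    x = refl
iter-suc f (suc k) x = cong f (iter-suc f k x)

iter-+ : ∀ {A : Set} (f : A → A) a b x → iter f (a + b) x ≡ iter f a (iter f b x)
iter-+ f zero    b x = refl
iter-+ f (suc a) b x = cong f (iter-+ f a b x)

iter-* : ∀ {A : Set} (f : A → A) p x → iter f p x ≡ x → ∀ k → iter f (k * p) x ≡ x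
iter-* f p x fᵖx≡x zero    = refl
iter-* f p x fᵖx≡x (suc k) = trans (iter-+ f p (k * p) x) (trans (cong (iter f p) (iter-* f p x fᵖx≡x k)) fᵖx≡x)

Least : (ℕ → Set) → ℕ → Set
Least P k = P k × (∀ i → i < k → ¬ P i)

least< : ∀ {P : ℕ → Set} → (∀ i → Dec (P i)) → ∀ b → (∃ λ k → k < b × Least P k) ⊎ (∀ i → i < b → ¬ P i)
least< P? zero = inj₂ λ i ()
least< {P} P? (suc b) with least< P? b
... | inj₁ (k , k<b , least) = inj₁ (k , m<n⇒m<1+n k<b , least)
... | inj₂ none with P? b
...   | yes pb = inj₁ (b , ≤-refl , pb , none)
...   | no ¬pb = inj₂ λ i i<1+b → case (m≤n⇒m<n∨m≡n (≤-pred i<1+b))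
  where
  case : ∀ {i} → i < b ⊎ i ≡ b → ¬ P i
  case (inj₁ i<b)  = none _ i<b
  case (inj₂ refl) = ¬pb

least : ∀ {P : ℕ → Set} → (∀ i → Dec (P i)) → ∀ {n} → P n → ∃ λ k → k ≤ n × Least P k
least P? {n} pn with least< P? (suc n)
... | inj₁ (k , k<1+n , least) = k , ≤-pred k<1+n , least
... | inj₂ none                = contradiction pn (none n ≤-refl)

finite-∀⊎ : ∀ {m} {R : Set} {S : Fin m → Set} → (∀ x → R ⊎ S x) → R ⊎ (∀ x → S x)
finite-∀⊎ {zero}          _ = inj₂ λ ()
finite-∀⊎ {suc m} {S = S} f with f fzero | finite-∀⊎ {S = S ∘ fsuc} (f ∘ fsuc)
... | inj₁ r  | _       = inj₁ r
... | inj₂ _  | inj₁ r  = inj₁ r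
... | inj₂ s₀ | inj₂ sₛ = inj₂ λ { fzero → s₀ ; (fsuc x) → sₛ x }

jumps : ∀ {P : ℕ → Set} ℓ → P 0 → (∀ {j} → P j → ∃ λ j′ → P j′ × j < j′ × j′ ≤ ℓ + j) →
        Σ (ℕ → ℕ) λ js → (∀ m → P (js m)) × (∀ {a b} → a < b → js a < js b) × (∀ m → js m ≤ m * ℓ)
jumps {P} ℓ p₀ next = proj₁ ∘ hop , proj₂ ∘ hop , increasing , bounded
  where
  hop : ℕ → Σ ℕ P
  hop zero    = 0 , p₀
  hop (suc m) = proj₁ (next (proj₂ (hop m))) , proj₁ (proj₂ (next (proj₂ (hop m))))
  increasing : ∀ {a b} → a < b → proj₁ (hop a) < proj₁ (hop b)
  increasing {a} {suc b} a<1+b with m≤n⇒m<n∨m≡n (≤-pred a<1+b)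
  ... | inj₁ a<b  = <-trans (increasing a<b) (proj₁ (proj₂ (proj₂ (next (proj₂ (hop b))))))
  ... | inj₂ refl = proj₁ (proj₂ (proj₂ (next (proj₂ (hop a)))))
  bounded : ∀ m → proj₁ (hop m) ≤ m * ℓ
  bounded zero    = z≤n
  bounded (suc m) = ≤-trans (proj₂ (proj₂ (proj₂ (next (proj₂ (hop m)))))) (+-monoʳ-≤ ℓ (bounded m))

module _ (G : Graph) where
  open Counting (finSummation (n G))

  adj-sym : ∀ {u v} → adj G u v ≡ true → adj G v u ≡ true
  adj-sym {u} {v} = trans (Graph.sym G v u)

  adj⇒≢ : ∀ {u v} → adj G u v ≡ true → u ≢ v
  adj⇒≢ {u} uu refl = contradiction (trans (sym uu) (irrefl G u)) λ ()

  deg≡# : ∀ v → deg G v ≡ # adj G v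
  deg≡# v = count≡sum (adj G v)

  otherNeighbour : ∀ {v} → 2 ≤ deg G v → ∀ a → ∃ λ y → adj G v y ≡ true × y ≢ a
  otherNeighbour {v} 2≤deg a
    with #-beyond-cover (adj G v) (λ _ → a) (≤-trans 2≤deg (≤-reflexive (deg≡# v)))
  ... | y , vy , y∉ = y , vy , y∉ fzero

  thirdNeighbour : ∀ {v} → 3 ≤ deg G v → ∀ a b → ∃ λ y → adj G v y ≡ true × y ≢ a × y ≢ b
  thirdNeighbour {v} 3≤deg a b
    with #-beyond-cover (adj G v) (λ { fzero → a ; (fsuc _) → b })
                        (≤-trans 3≤deg (≤-reflexive (deg≡# v)))
  ... | y , vy , y∉ = y , vy , y∉ fzero , y∉ (fsuc fzero)

  deg≡2⇒neighbours : ∀ {v a c x} → deg G v ≡ 2 → adj G v a ≡ true → adj G v c ≡ true → a ≢ c →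
                     adj G v x ≡ true → x ≡ a ⊎ x ≡ c
  deg≡2⇒neighbours {v} {a} {c} {x} deg≡2 va vc a≢c vx with x Finₚ.≟ a | x Finₚ.≟ c
  ... | yes x≡a | _       = inj₁ x≡a
  ... | no _    | yes x≡c = inj₂ x≡c
  ... | no x≢a  | no x≢c  = contradiction (≤-trans three≤# (≤-reflexive (trans (sym (deg≡# v)) deg≡2))) (n≮n 2)
    where
    three≤# : 3 ≤ # adj G v
    three≤# = #-≥-injection (finSummation _) (adj G v) (triple a c x)
                (triple-injective a≢c (x≢a ∘ sym) (x≢c ∘ sym))
                λ { fzero → va ; (fsuc fzero) → vc ; (fsuc (fsuc fzero)) → vx }

any-none : ∀ {A : Set} (p : A → Bool) xs → (∀ x → p x ≡ false) → any p xs ≡ false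
any-none p []       none = refl
any-none p (x ∷ xs) none rewrite none x = any-none p xs none

module _ (G : Graph) where
  private
    N : ℕ
    N = n G

  isBranch : Fin N → Bool
  isBranch v = ⌊ 3 ≤? deg G v ⌋

  isBranchDart : Fin N × Fin N → Bool
  isBranchDart (u , v) = adj G u v ∧ isBranch u

  isBranchDart-intro : ∀ {d} → adj G (proj₁ d) (proj₂ d) ≡ true → 3 ≤ deg G (proj₁ d) → isBranchDart d ≡ true
  isBranchDart-intro {u , v} uv 3≤deg = cong₂ _∧_ uv (⌊⌋-true (3 ≤? deg G u) 3≤deg)

  ∑deg≤2*edgeCount : sum (deg G) ≤ 2 * edgeCount G
  ∑deg≤2*edgeCount = begin
    sum (deg G)                               ≡⟨ sum-cong-≗ (deg≡# G) ⟩
    sum (λ u → sum (λ v → ind (adj G u v)))   ≤⟨ sum-mono-≤ (λ u → sum-mono-≤ (oriented u)) ⟩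
    sum (λ u → sum (λ v → e u v + e v u))     ≡⟨ sum-cong-≗ (λ u → ∑-distrib-+ (e u) (λ v → e v u)) ⟩
    sum (λ u → sum (e u) + sum (λ v → e v u)) ≡⟨ ∑-distrib-+ (sum ∘ e) (λ u → sum (λ v → e v u)) ⟩
    E + sum (λ u → sum (λ v → e v u))         ≡⟨ cong (E +_) (∑-comm (λ u v → e v u)) ⟩
    E + E                                     ≡⟨ cong (E +_) (+-identityʳ E) ⟨
    2 * E                                     ≡⟨ cong (2 *_) E≡edgeCount ⟩
    2 * edgeCount G                           ∎
    where
    open ≤-Reasoning
    e : Fin N → Fin N → ℕ
    e u v = ind ((toℕ u <ᵇ toℕ v) ∧ adj G u v)
    E : ℕ
    E = sum (sum ∘ e)
    E≡edgeCount : E ≡ edgeCount G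
    E≡edgeCount = sym (trans (sumFin≡sum (λ u → count (λ v → (toℕ u <ᵇ toℕ v) ∧ adj G u v)))
                             (sum-cong-≗ (λ u → count≡sum (λ v → (toℕ u <ᵇ toℕ v) ∧ adj G u v))))
    oriented : ∀ u v → ind (adj G u v) ≤ e u v + e v u
    oriented u v with adj G u v in uv
    ... | false = z≤n
    ... | true with <-cmp (toℕ u) (toℕ v)
    ...   | tri< u<v _ _ rewrite Equivalence.to T-≡ (<⇒<ᵇ u<v) = s≤s z≤n
    ...   | tri≈ _ u≡v _ = contradiction (Finₚ.toℕ-injective u≡v) (adj⇒≢ G uv)
    ...   | tri> _ _ v<u rewrite Equivalence.to T-≡ (<⇒<ᵇ v<u) | adj-sym G uv = m≤n+m 1 _

  6*n+#branchDarts≤3*∑deg : (∀ v → 2 ≤ deg G v) →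
                            6 * N + Counting.#_ (squareSummation N) isBranchDart ≤ 3 * sum (deg G)
  6*n+#branchDarts≤3*∑deg δ≥2 = begin
    6 * N + sum row             ≡⟨ cong (_+ sum row) (trans (*-comm 6 N) (sym (sum-const N 6))) ⟩
    sum {N} (λ _ → 6) + sum row ≡⟨ ∑-distrib-+ (λ _ → 6) row ⟨
    sum (λ u → 6 + row u)       ≤⟨ sum-mono-≤ perVertex ⟩
    sum (λ u → 3 * deg G u)     ≡⟨ *-distribˡ-sum 3 (deg G) ⟨
    3 * sum (deg G)             ∎
    where
    open ≤-Reasoning
    row : Fin N → ℕ
    row u = sum (λ v → ind (isBranchDart (u , v)))
    row≡ : ∀ u {b} → isBranch u ≡ b → row u ≡ sum (λ v → ind (adj G u v ∧ b))
    row≡ u refl = refl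
    perVertex : ∀ u → 6 + row u ≤ 3 * deg G u
    perVertex u = split (3 ≤? deg G u)
      where
      split : Dec (3 ≤ deg G u) → 6 + row u ≤ 3 * deg G u
      split (yes 3≤deg) = begin
        6 + row u                         ≡⟨ cong (6 +_) (row≡ u (⌊⌋-true (3 ≤? deg G u) 3≤deg)) ⟩
        6 + sum (λ v → ind (adj G u v ∧ true))
                                          ≡⟨ cong (6 +_) (sum-cong-≗ (λ v → cong ind (∧-identityʳ (adj G u v)))) ⟩
        6 + sum (λ v → ind (adj G u v))   ≡⟨ cong (6 +_) (deg≡# G u) ⟨
        6 + deg G u                       ≤⟨ +-monoˡ-≤ (deg G u) (+-mono-≤ 3≤deg (+-monoˡ-≤ 0 3≤deg)) ⟩
        deg G u + (deg G u + 0) + deg G u ≡⟨ +-comm (deg G u + (deg G u + 0)) (deg G u) ⟩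
        3 * deg G u                       ∎
      split (no 3≰deg) = begin
        6 + row u     ≡⟨ cong (6 +_) (row≡ u (⌊⌋-false (3 ≤? deg G u) 3≰deg)) ⟩
        6 + sum (λ v → ind (adj G u v ∧ false))
                      ≡⟨ cong (6 +_) (Counting.#-none (finSummation N) _ (λ v → ∧-zeroʳ (adj G u v))) ⟩
        3 * 2         ≡⟨ cong (3 *_) (≤-antisym (≮⇒≥ 3≰deg) (δ≥2 u)) ⟨
        3 * deg G u   ∎

  1≤componentCount : Fin N → 1 ≤ componentCount G
  1≤componentCount z =
    ≤-trans (#-≥-injection (finSummation N) root (λ (_ : Fin 1) → v₀) (λ { {fzero} {fzero} _ → refl })
                           (λ _ → v₀-root))
            (≤-reflexive (sym (count≡sum root)))
    where
    root : Fin N → Bool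
    root v = not (any (λ u → (toℕ u <ᵇ toℕ v) ∧ reach G N u v) (allFin N))
    0<N : 0 < N
    0<N = ≤-<-trans z≤n (Finₚ.toℕ<n z)
    v₀ : Fin N
    v₀ = fromℕ< 0<N
    v₀-root : root v₀ ≡ true
    v₀-root = cong not (any-none _ (allFin N) λ u →
                cong (λ i → (toℕ u <ᵇ i) ∧ reach G N u v₀) (Finₚ.toℕ-fromℕ< 0<N))

euler-contradiction : ∀ {V F E c B D} → V + F ≡ E + 2 * c → 1 ≤ c →
                      6 * F ≤ B → 6 * V + B ≤ 3 * D → D ≤ 2 * E → ⊥
euler-contradiction {V} {F} {E} {c} {B} {D} euler 1≤c 6F≤B 6V+B≤3D D≤2E = n≮n (6 * E) (begin-strict
  6 * E               <⟨ m<m+n (6 * E) z<s ⟩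
  6 * E + 12          ≤⟨ +-monoʳ-≤ (6 * E) (*-monoʳ-≤ 6 (*-monoʳ-≤ 2 1≤c)) ⟩
  6 * E + 6 * (2 * c) ≡⟨ *-distribˡ-+ 6 E (2 * c) ⟨
  6 * (E + 2 * c)     ≡⟨ cong (6 *_) euler ⟨
  6 * (V + F)         ≡⟨ *-distribˡ-+ 6 V F ⟩
  6 * V + 6 * F       ≤⟨ +-monoʳ-≤ (6 * V) 6F≤B ⟩
  6 * V + B           ≤⟨ 6V+B≤3D ⟩
  3 * D               ≤⟨ *-monoʳ-≤ 3 D≤2E ⟩
  3 * (2 * E)         ≡⟨ *-assoc 3 2 E ⟨
  6 * E               ∎)
  where open ≤-Reasoning

-- Closed non-backtracking walks contain cycles

module _ (G : Graph) (w : ℕ → Fin (n G))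
         (walk : ∀ t → adj G (w t) (w (suc t)) ≡ true)
         (nonBacktracking : ∀ t → w (suc (suc t)) ≢ w t) where

  Repeat : ℕ → ℕ → Set
  Repeat p g = 1 ≤ g × ∃ λ i → i + g ≤ p × w i ≡ w (i + g)

  private
    repeat? : ∀ p g → Dec (Repeat p g)
    repeat? p g with 1 ≤? g | least< (λ i → (i + g ≤? p) ×-dec (w i Finₚ.≟ w (i + g))) (suc p)
    ... | no g≱1  | _                          = no (g≱1 ∘ proj₁)
    ... | yes 1≤g | inj₁ (i , _ , repeats , _) = yes (1≤g , i , repeats)
    ... | yes _   | inj₂ none                  =
      no λ (_ , i , i+g≤p , eq) → none i (s≤s (≤-trans (m≤m+n i g) i+g≤p)) (i+g≤p , eq)

  -- The cycle is the stretch of the walk between the two ends of a repeat with the smallest gap.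
  closedWalk⇒cycle : ∀ {p} → 1 ≤ p → w p ≡ w 0 →
                     ∃ λ m → suc m ≤ p × Σ (Fin (suc m) → Fin (n G)) (IsCycle G m)
  closedWalk⇒cycle {p} 1≤p closed with least (repeat? p) (1≤p , 0 , ≤-refl , sym closed)
  ... | 0 , _ , (() , _) , _
  ... | 1 , _ , (_ , i , _ , eq) , _ = contradiction (trans eq (cong w (+-comm i 1))) (adj⇒≢ G (walk i))
  ... | 2 , _ , (_ , i , _ , eq) , _ = contradiction (sym (trans eq (cong w (+-comm i 2)))) (nonBacktracking i)
  ... | suc (suc (suc m′)) , g≤p , (_ , i , i+g≤p , eq) , shortest =
    m , g≤p , c , s≤s (s≤s z≤n) , c-injective , c-adjacent , c-closes
    where
    m : ℕ
    m = suc (suc m′)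
    c : Fin (suc m) → Fin (n G)
    c t = w (i + toℕ t)
    no-repeat : ∀ {a b} → a < b → b ≤ m → w (i + a) ≢ w (i + b)
    no-repeat {a} {b} a<b b≤m eq′ = shortest (b ∸ a) (s≤s (≤-trans (m∸n≤m b a) b≤m))
      (m<n⇒0<n∸m a<b , i + a , ≤-trans (≤-reflexive i+a+[b∸a]≡i+b) (≤-trans (+-monoʳ-≤ i (m≤n⇒m≤1+n b≤m)) i+g≤p)
      , trans eq′ (cong w (sym i+a+[b∸a]≡i+b)))
      where
      i+a+[b∸a]≡i+b : i + a + (b ∸ a) ≡ i + b
      i+a+[b∸a]≡i+b = trans (+-assoc i a (b ∸ a)) (cong (i +_) (m+[n∸m]≡n (<⇒≤ a<b)))
    c-injective : Injective _≡_ _≡_ c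
    c-injective {a} {b} eq′ with <-cmp (toℕ a) (toℕ b)
    ... | tri< a<b _ _ = contradiction eq′ (no-repeat a<b (≤-pred (Finₚ.toℕ<n b)))
    ... | tri≈ _ a≡b _ = Finₚ.toℕ-injective a≡b
    ... | tri> _ _ b<a = contradiction (sym eq′) (no-repeat b<a (≤-pred (Finₚ.toℕ<n a)))
    c-adjacent : ∀ (t : Fin m) → adj G (c (inject₁ t)) (c (fsuc t)) ≡ true
    c-adjacent t = subst₂ (λ x y → adj G (w (i + x)) (w y) ≡ true)
                          (sym (Finₚ.toℕ-inject₁ t)) (sym (+-suc i (toℕ t))) (walk (i + toℕ t))
    c-closes : adj G (c (fromℕ m)) (c fzero) ≡ true
    c-closes = subst₂ (λ x y → adj G (w (i + x)) y ≡ true)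
                      (sym (Finₚ.toℕ-fromℕ m))
                      (trans (cong w (sym (+-suc i m))) (trans (sym eq) (cong w (sym (+-identityʳ i)))))
                      (walk (i + m))

iter-fixed : ∀ {A : Set} (f : A → A) x → f x ≡ x → ∀ i → iter f i x ≡ x
iter-fixed f x fx≡x zero    = refl
iter-fixed f x fx≡x (suc i) = trans (cong f (iter-fixed f x fx≡x i)) fx≡x

module _ {G : Graph} (ρ : RotationSystem G) where

  rot-returns : ∀ {v a} → adj G v a ≡ true → ∃ λ p → iter (rot ρ v) (suc p) a ≡ a
  rot-returns {v} {a} va with cyclic ρ v (rot ρ v a) a (closed ρ v a va) va
  ... | p , reaches = p , trans (sym (iter-suc (rot ρ v) p a)) reaches

  rot-injective : ∀ {v a b} → adj G v a ≡ true → adj G v b ≡ true → rot ρ v a ≡ rot ρ v b → a ≡ b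
  rot-injective {v} {a} {b} va vb ra≡rb with rot-returns va | rot-returns vb
  ... | p , rᵖ⁺¹a≡a | q , rᵠ⁺¹b≡b = begin
    a                ≡⟨ sym fixedᵃ ⟩
    iter r (suc m) a ≡⟨ sym (iter-suc r m a) ⟩
    iter r m (r a)   ≡⟨ cong (iter r m) ra≡rb ⟩
    iter r m (r b)   ≡⟨ iter-suc r m b ⟩
    iter r (suc m) b ≡⟨ fixedᵇ ⟩
    b                ∎
    where
    open ≡-Reasoning
    r : Fin (n G) → Fin (n G)
    r = rot ρ v
    m : ℕ
    m = q + p * suc q
    fixedᵃ : iter r (suc m) a ≡ a
    fixedᵃ = subst (λ k → iter r k a ≡ a) (*-comm (suc q) (suc p)) (iter-* r (suc p) a rᵖ⁺¹a≡a (suc q))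
    fixedᵇ : iter r (suc m) b ≡ b
    fixedᵇ = iter-* r (suc q) b rᵠ⁺¹b≡b (suc p)

  rot-moves : ∀ {v u} → 2 ≤ deg G v → adj G v u ≡ true → rot ρ v u ≢ u
  rot-moves {v} {u} 2≤deg vu ru≡u with otherNeighbour G 2≤deg u
  ... | y , vy , y≢u with cyclic ρ v u y vu vy
  ...   | i , reaches = y≢u (trans (sym reaches) (iter-fixed (rot ρ v) u ru≡u i))

module Faces {G : Graph} (ρ : RotationSystem G) where

  N : ℕ
  N = n G

  Dart : Set
  Dart = Fin N × Fin N

  dartSummation : Summation Dart
  dartSummation = squareSummation N

  open Summation dartSummation public using (∑-sum-comm) renaming (∑ to ∑ᴰ; _≟_ to _≟ᴰ_)

  ∑ᴰ-comm : ∀ (g : Dart → Dart → ℕ) → ∑ᴰ (λ x → ∑ᴰ (g x)) ≡ ∑ᴰ (λ y → ∑ᴰ (λ x → g x y))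
  ∑ᴰ-comm g = trans (∑-sum-comm (λ x u → sum (λ v → g x (u , v))))
                    (sum-cong-≗ (λ u → ∑-sum-comm (λ x v → g x (u , v))))

  IsEdge : Dart → Set
  IsEdge d = adj G (proj₁ d) (proj₂ d) ≡ true

  orbit : Dart → ℕ → Dart
  orbit d i = iter (faceStep G ρ) i d

  faceStep-edge : ∀ {d} → IsEdge d → IsEdge (faceStep G ρ d)
  faceStep-edge {u , v} uv = closed ρ v u (adj-sym G uv)

  orbit-edge : ∀ {d} → IsEdge d → ∀ i → IsEdge (orbit d i)
  orbit-edge e zero    = e
  orbit-edge e (suc i) = faceStep-edge (orbit-edge e i)

  faceStep-injective : ∀ {d d′} → IsEdge d → IsEdge d′ → faceStep G ρ d ≡ faceStep G ρ d′ → d ≡ d′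
  faceStep-injective {u , v} {u′ , v′} uv u′v′ eq with cong proj₁ eq
  ... | refl = cong (_, v) (rot-injective ρ (adj-sym G uv) (adj-sym G u′v′) (cong proj₂ eq))

  orbit-+ : ∀ d a b → orbit d (a + b) ≡ orbit (orbit d b) a
  orbit-+ d a b = iter-+ (faceStep G ρ) a b d

  orbit-cancel : ∀ {d} → IsEdge d → ∀ a m → orbit d a ≡ orbit d (a + m) → d ≡ orbit d m
  orbit-cancel e zero    m eq = eq
  orbit-cancel e (suc a) m eq =
    orbit-cancel e a m (faceStep-injective (orbit-edge e a) (orbit-edge e (a + m)) eq)

  private
    code : Dart → Fin (N * N)
    code (u , v) = combine u v

    code-injective : ∀ {x y} → code x ≡ code y → x ≡ y
    code-injective {u , v} {u′ , v′} eq with Finₚ.combine-injective u v u′ v′ eq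
    ... | refl , refl = refl

  -- Pigeonhole on the N * N + 1 darts orbit d 0, …, orbit d (N * N).
  orbit-returns : ∀ {d} → IsEdge d → ∃ λ p → 1 ≤ p × p ≤ N * N × orbit d p ≡ d
  orbit-returns {d} e with Finₚ.pigeonhole ≤-refl (λ (i : Fin (suc (N * N))) → code (orbit d (toℕ i)))
  ... | i , j , i<j , same = toℕ j ∸ toℕ i , m<n⇒0<n∸m i<j
                           , ≤-trans (m∸n≤m (toℕ j) (toℕ i)) (≤-pred (Finₚ.toℕ<n j))
                           , sym (orbit-cancel e (toℕ i) _ (trans (code-injective same)
                                                                  (cong (orbit d) (sym (m+[n∸m]≡n (<⇒≤ i<j))))))

  record Period (d : Dart) : Set where
    field
      p       : ℕ
      1≤p     : 1 ≤ p
      p≤N²    : p ≤ N * N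
      returns : orbit d p ≡ d
      minimal : ∀ q → q < p → ¬ (1 ≤ q × orbit d q ≡ d)

  -- Abstract, so that type checking never unfolds the search that produces the period.
  abstract
    period : ∀ {d} → IsEdge d → Period d
    period {d} e with orbit-returns e
    ... | p₀ , 1≤p₀ , p₀≤N² , returns₀
      with least (λ q → (1 ≤? q) ×-dec (orbit d q ≟ᴰ d)) (1≤p₀ , returns₀)
    ...   | p , p≤p₀ , (1≤p , returns) , minimal = record
      { p = p ; 1≤p = 1≤p ; p≤N² = ≤-trans p≤p₀ p₀≤N² ; returns = returns ; minimal = minimal }

  module Orbit {d : Dart} (e : IsEdge d) where
    open Period (period e) public

    orbit-distinct : ∀ {i j} → i < j → j < p → orbit d i ≢ orbit d j
    orbit-distinct {i} {j} i<j j<p eq = minimal (j ∸ i) (≤-<-trans (m∸n≤m j i) j<p)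
      (m<n⇒0<n∸m i<j , sym (orbit-cancel e i (j ∸ i) (trans eq (cong (orbit d) (sym (m+[n∸m]≡n (<⇒≤ i<j)))))))

    orbit-injective : ∀ {i j} → i < p → j < p → orbit d i ≡ orbit d j → i ≡ j
    orbit-injective {i} {j} i<p j<p eq with <-cmp i j
    ... | tri< i<j _ _ = contradiction eq (orbit-distinct i<j j<p)
    ... | tri≈ _ i≡j _ = i≡j
    ... | tri> _ _ j<i = contradiction (sym eq) (orbit-distinct j<i i<p)

    orbit-reduce : ∀ m → ∃ λ s → s < p × orbit d m ≡ orbit d s
    orbit-reduce zero = 0 , 1≤p , refl
    orbit-reduce (suc m) with orbit-reduce m
    ... | s , s<p , eq with m≤n⇒m<n∨m≡n s<p
    ...   | inj₁ 1+s<p = suc s , 1+s<p , cong (faceStep G ρ) eq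
    ...   | inj₂ 1+s≡p = 0 , 1≤p , trans (cong (faceStep G ρ) eq) (trans (cong (orbit d) 1+s≡p) returns)

    orbit-back : ∀ m → ∃ λ t → orbit (orbit d m) t ≡ d
    orbit-back m with orbit-reduce m
    ... | s , s<p , eq = p ∸ s , (begin
      orbit (orbit d m) (p ∸ s) ≡⟨ cong (λ x → orbit x (p ∸ s)) eq ⟩
      orbit (orbit d s) (p ∸ s) ≡⟨ orbit-+ d (p ∸ s) s ⟨
      orbit d (p ∸ s + s)       ≡⟨ cong (orbit d) (m∸n+n≡m (<⇒≤ s<p)) ⟩
      orbit d p                 ≡⟨ returns ⟩
      d                         ∎)
      where open ≡-Reasoning

-- Walks through vertices of degree two

walkIn-head : ∀ {G P a b} → WalkIn G P a b → P a
walkIn-head (here pa)     = pa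
walkIn-head (step pa _ _) = pa

walkIn-invariant : ∀ {G P a b} (Q : Fin (n G) → Set) →
                   (∀ {x y} → P x → Q x → adj G x y ≡ true → P y → Q y) →
                   WalkIn G P a b → Q a → Q b
walkIn-invariant Q preserved (here _)        qa = qa
walkIn-invariant Q preserved (step pa xy ys) qa =
  walkIn-invariant Q preserved ys (preserved pa qa xy (walkIn-head ys))

branch≢inner : ∀ G {x y} → 3 ≤ deg G x → deg G y ≡ 2 → x ≢ y
branch≢inner G 3≤deg deg≡2 refl = n≮n 2 (≤-trans 3≤deg (≤-reflexive deg≡2))

module SuspendedWalk (G : Graph) (2-conn : TwoConnected G) (w : ℕ → Fin (n G))
                     (walk : ∀ t → adj G (w t) (w (suc t)) ≡ true)
                     (nonBacktracking : ∀ t → w (suc (suc t)) ≢ w t)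
                     {k : ℕ} (1≤k : 1 ≤ k) (start : 3 ≤ deg G (w 0)) (end : 3 ≤ deg G (w k))
                     (inner : ∀ t → 0 < t → t < k → deg G (w t) ≡ 2) where

  inner-neighbours : ∀ {t x} → suc t < k → adj G (w (suc t)) x ≡ true → x ≡ w t ⊎ x ≡ w (suc (suc t))
  inner-neighbours {t} 1+t<k =
    deg≡2⇒neighbours G (inner (suc t) z<s 1+t<k) (adj-sym G (walk t)) (walk (suc t)) (nonBacktracking t ∘ sym)

  repeat⇒ends : ∀ {i j} → j ≤ k → i < j → w i ≡ w j → i ≡ 0 × j ≡ k
  repeat⇒ends {zero}  {suc j} j≤k _ eq with m≤n⇒m<n∨m≡n j≤k
  ... | inj₁ j<k = contradiction eq (branch≢inner G start (inner (suc j) z<s j<k))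
  ... | inj₂ j≡k = refl , j≡k
  repeat⇒ends {suc i} {suc j} j≤k i<j eq with m≤n⇒m<n∨m≡n j≤k
  ... | inj₂ refl = contradiction (sym eq) (branch≢inner G end (inner (suc i) z<s i<j))
  ... | inj₁ 1+j<k
    with inner-neighbours (<-trans i<j 1+j<k) (adj-sym G (subst (λ x → adj G (w j) x ≡ true) (sym eq) (walk j)))
  ...   | inj₁ wj≡wi = contradiction (proj₂ (repeat⇒ends (<⇒≤ j<k) (≤-pred i<j) (sym wj≡wi))) (<⇒≢ j<k)
    where
    j<k : j < k
    j<k = ≤-trans (n<1+n j) j≤k
  ...   | inj₂ wj≡w2+i with <-cmp (suc (suc i)) j
  ...     | tri< 2+i<j _ _ =
    contradiction (proj₁ (repeat⇒ends (≤-trans (n≤1+n j) j≤k) 2+i<j (sym wj≡w2+i))) λ ()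
  ...     | tri≈ _ refl _  = contradiction (sym eq) (nonBacktracking (suc i))
  ...     | tri> _ _ j<2+i with ≤-antisym (≤-pred j<2+i) (≤-pred i<j)
  ...       | refl = contradiction wj≡w2+i (adj⇒≢ G (walk (suc i)))

  -- If the walk returned to its start u = w 0, its inner vertices would be closed under
  -- adjacency in G - u, so the third neighbour of u would be inner; but inner vertices only
  -- see u through w 1 and w (k - 1).
  private
    module Returning (wk≡w0 : w k ≡ w 0) where
      Inner : Fin (n G) → Set
      Inner x = ∃ λ t → 0 < t × t < k × w t ≡ x

      inner-closed : ∀ {x z} → x ≢ w 0 → Inner x → adj G x z ≡ true → z ≢ w 0 → Inner z
      inner-closed _ (suc t , _ , 1+t<k , refl) xz z≢u with inner-neighbours 1+t<k xz
      inner-closed _ (suc zero , _ , _ , refl) _ z≢u | inj₁ z≡w0 = contradiction z≡w0 z≢u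
      inner-closed _ (suc (suc t) , _ , 2+t<k , refl) _ _ | inj₁ z≡w1+t =
        suc t , z<s , <-trans (n<1+n _) 2+t<k , sym z≡w1+t
      inner-closed _ (suc t , _ , 1+t<k , refl) _ z≢u | inj₂ z≡w2+t with m≤n⇒m<n∨m≡n 1+t<k
      ... | inj₁ 2+t<k = suc (suc t) , z<s , 2+t<k , sym z≡w2+t
      ... | inj₂ 2+t≡k = contradiction (trans z≡w2+t (trans (cong w 2+t≡k) wk≡w0)) z≢u

      third-not-inner : ∀ {y} → adj G (w 0) y ≡ true → y ≢ w 1 → y ≢ w (pred k) → ¬ Inner y
      third-not-inner uy _ _ (suc t , _ , 1+t<k , refl) with inner-neighbours 1+t<k (adj-sym G uy)
      third-not-inner _ y≢w1 _ (suc zero , _ , _ , refl) | inj₁ _ = y≢w1 refl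
      third-not-inner _ _ _ (suc (suc t) , _ , 2+t<k , refl) | inj₁ w0≡w1+t =
        <⇒≢ (<-trans (n<1+n _) 2+t<k) (proj₂ (repeat⇒ends (<⇒≤ (<-trans (n<1+n _) 2+t<k)) z<s w0≡w1+t))
      third-not-inner _ _ y≢wk-1 (suc t , _ , 1+t<k , refl) | inj₂ w0≡w2+t with m≤n⇒m<n∨m≡n 1+t<k
      ... | inj₁ 2+t<k = <⇒≢ 2+t<k (proj₂ (repeat⇒ends (<⇒≤ 2+t<k) z<s w0≡w2+t))
      ... | inj₂ 2+t≡k = y≢wk-1 (cong (w ∘ pred) 2+t≡k)

      absurd : ⊥
      absurd with m≤n⇒m<n∨m≡n 1≤k
      ... | inj₂ 1≡k = adj⇒≢ G (walk 0) (sym (trans (cong w 1≡k) wk≡w0))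
      ... | inj₁ 1<k with thirdNeighbour G start (w 1) (w (pred k))
      ...   | y , uy , y≢w1 , y≢wk-1 = third-not-inner uy y≢w1 y≢wk-1
        (walkIn-invariant Inner inner-closed
          (proj₂ (proj₂ 2-conn) (w 0) (w 1) y (adj⇒≢ G (walk 0) ∘ sym) (adj⇒≢ G uy ∘ sym))
          (1 , z<s , 1<k , refl))

  ends-differ : w k ≢ w 0
  ends-differ = Returning.absurd

  no-repeat : ∀ {i j} → i < j → j ≤ k → w i ≢ w j
  no-repeat i<j j≤k eq with repeat⇒ends j≤k i<j eq
  ... | refl , refl = ends-differ (sym eq)

  suspendedPath : SuspendedPath G k (w ∘ toℕ)
  suspendedPath = injective , adjacent , ends-differ ∘ sym ∘ subst (λ j → w 0 ≡ w j) (Finₚ.toℕ-fromℕ k)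
                , start , subst (λ j → 3 ≤ deg G (w j)) (sym (Finₚ.toℕ-fromℕ k)) end , inner ∘ toℕ
    where
    injective : Injective _≡_ _≡_ (w ∘ toℕ)
    injective {a} {b} eq with <-cmp (toℕ a) (toℕ b)
    ... | tri< a<b _ _ = contradiction eq (no-repeat a<b (≤-pred (Finₚ.toℕ<n b)))
    ... | tri≈ _ a≡b _ = Finₚ.toℕ-injective a≡b
    ... | tri> _ _ b<a = contradiction (sym eq) (no-repeat b<a (≤-pred (Finₚ.toℕ<n a)))
    adjacent : ∀ (i : Fin k) → adj G (w (toℕ (inject₁ i))) (w (suc (toℕ i))) ≡ true
    adjacent i = subst (λ j → adj G (w j) (w (suc (toℕ i))) ≡ true) (sym (Finₚ.toℕ-inject₁ i)) (walk (toℕ i))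

-- Walking along a face

module FaceWalks {G : Graph} (ρ : RotationSystem G) (δ≥2 : ∀ v → 2 ≤ deg G v) where
  open Faces ρ

  module _ {d : Dart} (e : IsEdge d) where
    open Orbit e

    corner : ℕ → Fin N
    corner t = proj₁ (orbit d t)

    corner-adj : ∀ t → adj G (corner t) (corner (suc t)) ≡ true
    corner-adj = orbit-edge e

    corner-nonBacktracking : ∀ t → corner (suc (suc t)) ≢ corner t
    corner-nonBacktracking t = rot-moves ρ (δ≥2 _) (adj-sym G (corner-adj t))

    girth≤period : ∀ {g} → GirthAtLeast G g → g ≤ p
    girth≤period girth with closedWalk⇒cycle G corner corner-adj corner-nonBacktracking 1≤p (cong proj₁ returns)
    ... | m , 1+m≤p , c , cycle = ≤-trans (girth m c cycle) 1+m≤p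

    suspendedPathAlong : TwoConnected G → 3 ≤ deg G (corner 0) →
                         ∃ λ k → 1 ≤ k × 3 ≤ deg G (corner k) × SuspendedPath G k (corner ∘ toℕ)
    suspendedPathAlong 2-conn start
      with least (λ t → (1 ≤? t) ×-dec (3 ≤? deg G (corner t)))
                 (1≤p , subst (λ x → 3 ≤ deg G (proj₁ x)) (sym returns) start)
    ... | k , _ , (1≤k , end) , first = k , 1≤k , end , suspendedPath
      where
      inner : ∀ t → 0 < t → t < k → deg G (corner t) ≡ 2
      inner t 0<t t<k = ≤-antisym (≮⇒≥ (λ 2<deg → first t t<k (0<t , 2<deg))) (δ≥2 _)
      open SuspendedWalk G 2-conn corner corner-adj corner-nonBacktracking 1≤k start end inner

    OnFace : Fin N → Set
    OnFace x = ∃ λ t → corner t ≡ x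

    corners-inner : (∀ i → i < p → ¬ 3 ≤ deg G (corner i)) → ∀ t → deg G (corner t) ≡ 2
    corners-inner none t with orbit-reduce t
    ... | s , s<p , eq = trans (cong (deg G ∘ proj₁) eq) (≤-antisym (≮⇒≥ (none s s<p)) (δ≥2 _))

    corner-entered : ∀ t → ∃ λ t′ → corner (suc t′) ≡ corner t
    corner-entered zero    = pred p , cong proj₁ (trans (cong (orbit d) (suc-pred p {{>-nonZero 1≤p}})) returns)
    corner-entered (suc t) = t , refl

    onFace-closed : (∀ t → deg G (corner t) ≡ 2) → ∀ {x y} → OnFace x → adj G x y ≡ true → OnFace y
    onFace-closed inner (t , refl) xy with corner-entered t
    ... | t′ , eq with deg≡2⇒neighbours G (inner (suc t′)) (adj-sym G (corner-adj t′)) (corner-adj (suc t′))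
                         (corner-nonBacktracking t′ ∘ sym) (subst (λ x → adj G x _ ≡ true) (sym eq) xy)
    ...   | inj₁ y≡corner-t′   = t′ , sym y≡corner-t′
    ...   | inj₂ y≡corner-2+t′ = suc (suc t′) , sym y≡corner-2+t′

    face-has-branch : Connected G → ∀ {z} → 3 ≤ deg G z → ∃ λ i → 3 ≤ deg G (corner i)
    face-has-branch conn {z} 3≤deg with least< (λ i → 3 ≤? deg G (corner i)) p
    ... | inj₁ (i , _ , branch , _) = i , branch
    ... | inj₂ none
      with walkIn-invariant OnFace (λ _ onFace xy _ → onFace-closed (corners-inner none) onFace xy)
                            (conn (corner 0) z) (0 , refl)
    ...   | t , refl = contradiction refl (branch≢inner G 3≤deg (corners-inner none t))

-- Counting faces

module FaceCounting {G : Graph} (ρ : RotationSystem G) (δ≥2 : ∀ v → 2 ≤ deg G v) where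
  open Faces ρ
  open FaceWalks ρ δ≥2
  open Counting dartSummation
  open Summation dartSummation using (∑-mono-≤; ∑-*ˡ)

  faceCount≡#faceReps : faceCount G ρ ≡ # isFaceRep G ρ
  faceCount≡#faceReps = begin
    faceCount G ρ       ≡⟨ cong₂ _+_ (trans (sumFin≡sum (λ u → count (λ v → isFaceRep G ρ (u , v))))
                                            (sum-cong-≗ (λ u → count≡sum (λ v → isFaceRep G ρ (u , v)))))
                                     isolatedCount≡0 ⟩
    # isFaceRep G ρ + 0 ≡⟨ +-identityʳ _ ⟩
    # isFaceRep G ρ     ∎
    where
    open ≡-Reasoning
    hasNeighbour : ∀ v → any (adj G v) (allFin N) ≡ true
    hasNeighbour v with otherNeighbour G (δ≥2 v) v
    ... | y , vy , _ = Equivalence.to T-≡ (any⁺ (adj G v) (lose (∈-allFin y) (Equivalence.from T-≡ vy)))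
    isolatedCount≡0 : isolatedCount G ρ ≡ 0
    isolatedCount≡0 = trans (count≡sum (λ v → not (any (adj G v) (allFin N))))
                            (Counting.#-none (finSummation N) _ (λ v → cong not (hasNeighbour v)))

  private
    key : Dart → ℕ
    key = dartKey G ρ

    toℕ-combine≡key : ∀ u v → toℕ (combine u v) ≡ key (u , v)
    toℕ-combine≡key u v = trans (Finₚ.toℕ-combine u v) (cong (_+ toℕ v) (*-comm N (toℕ u)))

  key-injective : ∀ {x y} → key x ≡ key y → x ≡ y
  key-injective {u , v} {u′ , v′} eq with Finₚ.combine-injective u v u′ v′
    (Finₚ.toℕ-injective (trans (toℕ-combine≡key u v) (trans eq (sym (toℕ-combine≡key u′ v′)))))
  ... | refl , refl = refl

  faceRep-edge : ∀ {r} → isFaceRep G ρ r ≡ true → IsEdge r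
  faceRep-edge {r} rep = ∧-conicalˡ _ _ rep

  faceRep-least : ∀ {r} → isFaceRep G ρ r ≡ true → ∀ {i} → i < N * N → key r ≤ key (orbit r i)
  faceRep-least {r} rep {i} i<N² = ≤ᵇ⇒≤ (key r) (key (orbit r i))
    (lookup (all⁺ _ (upTo (N * N)) (Equivalence.from T-≡ (∧-conicalʳ _ _ rep))) (∈-upTo⁺ i<N²))

  inOrbit : Dart → Dart → Bool
  inOrbit r x = ⌊ Finₚ.any? (λ (i : Fin (N * N)) → orbit r (toℕ i) ≟ᴰ x) ⌋

  inOrbit-orbit : ∀ {r} → IsEdge r → ∀ m → inOrbit r (orbit r m) ≡ true
  inOrbit-orbit {r} e m with Orbit.orbit-reduce e m
  ... | s , s<p , eq = ⌊⌋-true (Finₚ.any? (λ (i : Fin (N * N)) → orbit r (toℕ i) ≟ᴰ orbit r m))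
                               (fromℕ< s<N² , trans (cong (orbit r) (Finₚ.toℕ-fromℕ< s<N²)) (sym eq))
    where
    s<N² : s < N * N
    s<N² = ≤-trans s<p (Orbit.p≤N² e)

  inOrbit⇒ : ∀ {r x} → inOrbit r x ≡ true → ∃ λ i → orbit r i ≡ x
  inOrbit⇒ {r} {x} found with ⌊⌋-true⁻ (Finₚ.any? (λ (i : Fin (N * N)) → orbit r (toℕ i) ≟ᴰ x)) found
  ... | i , eq = toℕ i , eq

  shared⇒reaches : ∀ {r r′ x} → IsEdge r → IsEdge r′ → inOrbit r x ≡ true → inOrbit r′ x ≡ true →
                   ∃ λ s → s < N * N × orbit r s ≡ r′
  shared⇒reaches {r} {r′} {x} e e′ rx r′x with inOrbit⇒ rx | inOrbit⇒ r′x
  ... | i , rᵢ≡x | j , r′ⱼ≡x with Orbit.orbit-back e′ j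
  ...   | t , back with Orbit.orbit-reduce e (t + i)
  ...     | s , s<p , eq = s , ≤-trans s<p (Orbit.p≤N² e) , (begin
    orbit r s             ≡⟨ eq ⟨
    orbit r (t + i)       ≡⟨ orbit-+ r t i ⟩
    orbit (orbit r i) t   ≡⟨ cong (λ y → orbit y t) (trans rᵢ≡x (sym r′ⱼ≡x)) ⟩
    orbit (orbit r′ j) t  ≡⟨ back ⟩
    r′                    ∎)
    where open ≡-Reasoning

  faceRep-key≤ : ∀ {r r′ x} → isFaceRep G ρ r ≡ true → isFaceRep G ρ r′ ≡ true →
                 inOrbit r x ≡ true → inOrbit r′ x ≡ true → key r ≤ key r′
  faceRep-key≤ {r} {r′} {x} rep rep′ rx r′x
    with shared⇒reaches {r} {r′} {x} (faceRep-edge {r} rep) (faceRep-edge {r′} rep′) rx r′x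
  ... | s , s<N² , rₛ≡r′ = subst (λ y → key r ≤ key y) rₛ≡r′ (faceRep-least {r} rep s<N²)

  faceRep-unique : ∀ {r r′ x} → isFaceRep G ρ r ≡ true → isFaceRep G ρ r′ ≡ true →
                   inOrbit r x ≡ true → inOrbit r′ x ≡ true → r ≡ r′
  faceRep-unique {r} {r′} {x} rep rep′ rx r′x =
    key-injective {r} {r′} (≤-antisym (faceRep-key≤ {r} {r′} {x} rep rep′ rx r′x)
                                      (faceRep-key≤ {r′} {r} {x} rep′ rep r′x rx))

  -- Walking along the face of d from a branch vertex, the next branch vertex comes within ℓ steps,
  -- i.e. the suspended path traced from d has at most ℓ edges.
  NextBranchWithin : ℕ → Dart → Set
  NextBranchWithin ℓ d = IsEdge d → 3 ≤ deg G (proj₁ d) → ∃ λ k → 1 ≤ k × k ≤ ℓ × 3 ≤ deg G (proj₁ (orbit d k))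

  module _ {ℓ} (short : ∀ d → NextBranchWithin ℓ d) (girth : GirthAtLeast G (5 * ℓ + 1))
               (conn : Connected G) {z} (3≤deg : 3 ≤ deg G z) where

    -- From a branch dart s of the face, hop ahead by at most ℓ to the next branch dart, five times;
    -- the six darts reached are distinct because the face has length at least 5ℓ + 1.
    six-branch-darts : ∀ {r} → isFaceRep G ρ r ≡ true → 6 ≤ # (λ x → isBranchDart G x ∧ inOrbit r x)
    six-branch-darts {r} rep with face-has-branch (faceRep-edge {r} rep) conn 3≤deg
    ... | i , branchᵢ =
      #-≥-injection dartSummation (λ x → isBranchDart G x ∧ inOrbit r x) darts darts-injective on-face
      where
      e : IsEdge r
      e = faceRep-edge {r} rep
      s : Dart
      s = orbit r i
      eₛ : IsEdge s
      eₛ = orbit-edge e i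
      Branch : ℕ → Set
      Branch j = 3 ≤ deg G (proj₁ (orbit s j))
      next : ∀ {j} → Branch j → ∃ λ j′ → Branch j′ × j < j′ × j′ ≤ ℓ + j
      next {j} branch with short (orbit s j) (orbit-edge eₛ j) branch
      ... | k , 1≤k , k≤ℓ , branchₖ = k + j , subst (λ x → 3 ≤ deg G (proj₁ x)) (sym (orbit-+ s k j)) branchₖ
                                    , +-monoˡ-≤ j 1≤k , +-monoˡ-≤ j k≤ℓ
      hops : Σ (ℕ → ℕ) λ js → (∀ m → Branch (js m)) × (∀ {a b} → a < b → js a < js b) × (∀ m → js m ≤ m * ℓ)
      hops = jumps {Branch} ℓ branchᵢ next
      js : ℕ → ℕ
      js = proj₁ hops
      js-branch : ∀ m → Branch (js m)
      js-branch = proj₁ (proj₂ hops)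
      js-increasing : ∀ {a b} → a < b → js a < js b
      js-increasing = proj₁ (proj₂ (proj₂ hops))
      js≤5ℓ : ∀ (m : Fin 6) → js (toℕ m) ≤ 5 * ℓ
      js≤5ℓ m = ≤-trans (proj₂ (proj₂ (proj₂ hops)) (toℕ m)) (*-monoˡ-≤ ℓ (≤-pred (Finₚ.toℕ<n m)))
      js< : ∀ (m : Fin 6) → js (toℕ m) < Orbit.p eₛ
      js< m = ≤-trans (s≤s (js≤5ℓ m)) (≤-trans (≤-reflexive (+-comm 1 (5 * ℓ))) (girth≤period eₛ girth))
      darts : Fin 6 → Dart
      darts m = orbit s (js (toℕ m))
      darts-injective : Injective _≡_ _≡_ darts
      darts-injective {a} {b} eq with <-cmp (toℕ a) (toℕ b)
      ... | tri< a<b _ _ = contradiction (Orbit.orbit-injective eₛ (js< a) (js< b) eq) (<⇒≢ (js-increasing a<b))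
      ... | tri≈ _ a≡b _ = Finₚ.toℕ-injective a≡b
      ... | tri> _ _ b<a =
        contradiction (Orbit.orbit-injective eₛ (js< b) (js< a) (sym eq)) (<⇒≢ (js-increasing b<a))
      on-face : ∀ m → (isBranchDart G (darts m) ∧ inOrbit r (darts m)) ≡ true
      on-face m = cong₂ _∧_ (isBranchDart-intro G (orbit-edge eₛ (js (toℕ m))) (js-branch (toℕ m)))
                            (subst (λ x → inOrbit r x ≡ true) (orbit-+ r (js (toℕ m)) i)
                                   (inOrbit-orbit e (js (toℕ m) + i)))

    6*#faceReps≤#branchDarts : 6 * # isFaceRep G ρ ≤ # isBranchDart G
    6*#faceReps≤#branchDarts = begin
      6 * # isFaceRep G ρ                ≡⟨ ∑-*ˡ 6 (ind ∘ isFaceRep G ρ) ⟨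
      ∑ᴰ (λ r → 6 * ind (isFaceRep G ρ r)) ≤⟨ ∑-mono-≤ perFace ⟩
      ∑ᴰ (λ r → ∑ᴰ (λ x → meets x r))    ≡⟨ ∑ᴰ-comm meets ⟨
      ∑ᴰ (λ x → ∑ᴰ (meets x))            ≤⟨ ∑-mono-≤ perDart ⟩
      # isBranchDart G                   ∎
      where
      open ≤-Reasoning
      meets : Dart → Dart → ℕ
      meets x r = ind (isFaceRep G ρ r ∧ (isBranchDart G x ∧ inOrbit r x))
      perFace : ∀ r → 6 * ind (isFaceRep G ρ r) ≤ ∑ᴰ (λ x → meets x r)
      perFace r with isFaceRep G ρ r in rep
      ... | true  = six-branch-darts {r} rep
      ... | false = z≤n
      perDart : ∀ x → ∑ᴰ (meets x) ≤ ind (isBranchDart G x)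
      perDart x with isBranchDart G x
      ... | false = ≤-reflexive (#-none (λ r → isFaceRep G ρ r ∧ false) (λ r → ∧-zeroʳ (isFaceRep G ρ r)))
      ... | true  = #-≤1 (λ r → isFaceRep G ρ r ∧ inOrbit r x) λ r r′ rx r′x →
        faceRep-unique {r} {r′} {x} (∧-conicalˡ (isFaceRep G ρ r) _ rx) (∧-conicalˡ (isFaceRep G ρ r′) _ r′x)
                                    (∧-conicalʳ _ (inOrbit r x) rx) (∧-conicalʳ _ (inOrbit r′ x) r′x)

LongSuspendedPath : Graph → ℕ → Set
LongSuspendedPath G ℓ = Σ ℕ λ k → (ℓ + 1 ≤ k) × Σ (Fin (suc k) → Fin (n G)) (SuspendedPath G k)

module _ {G : Graph} (ρ : RotationSystem G) (δ≥2 : ∀ v → 2 ≤ deg G v) (2-conn : TwoConnected G) (ℓ : ℕ) where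
  open Faces ρ
  open FaceWalks ρ δ≥2
  open FaceCounting ρ δ≥2

  long-or-nextBranchWithin : ∀ d → LongSuspendedPath G ℓ ⊎ NextBranchWithin ℓ d
  long-or-nextBranchWithin d with adj G (proj₁ d) (proj₂ d) Bool.≟ true | 3 ≤? deg G (proj₁ d)
  ... | no ¬e | _         = inj₂ λ e _ → contradiction e ¬e
  ... | yes _ | no ¬start = inj₂ λ _ start → contradiction start ¬start
  ... | yes e | yes start with suspendedPathAlong {d} e 2-conn start
  ...   | k , 1≤k , end , path with ℓ + 1 ≤? k
  ...     | yes ℓ<k = inj₁ (k , ℓ<k , corner {d} e ∘ toℕ , path)
  ...     | no ℓ≮k  = inj₂ λ _ _ → k , 1≤k , ≤-pred (≤-trans (≰⇒> ℓ≮k) (≤-reflexive (+-comm ℓ 1))) , end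

  long-or-short : LongSuspendedPath G ℓ ⊎ (∀ d → NextBranchWithin ℓ d)
  long-or-short = map₂ (λ short d → short (proj₁ d) (proj₂ d))
                       (finite-∀⊎ {S = λ u → ∀ v → NextBranchWithin ℓ (u , v)} λ u →
                          finite-∀⊎ {S = λ v → NextBranchWithin ℓ (u , v)} λ v → long-or-nextBranchWithin (u , v))

  euler⇒¬nextBranchesWithin : n G + faceCount G ρ ≡ edgeCount G + 2 * componentCount G →
                              GirthAtLeast G (5 * ℓ + 1) →
                              ∀ {z} → 3 ≤ deg G z → ¬ (∀ d → NextBranchWithin ℓ d)
  euler⇒¬nextBranchesWithin euler girth {z} 3≤deg short =
    euler-contradiction {n G} {# isFaceRep G ρ} {edgeCount G} {componentCount G} {# isBranchDart G} {sum (deg G)}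
      (trans (cong (n G +_) (sym faceCount≡#faceReps)) euler)
      (1≤componentCount G z)
      (6*#faceReps≤#branchDarts short girth (proj₁ (proj₂ 2-conn)) 3≤deg)
      (6*n+#branchDarts≤3*∑deg G δ≥2)
      (∑deg≤2*edgeCount G)
    where open Counting dartSummation

lemma22 : (ℓ : ℕ) (G : Graph) →
    Planar G → TwoConnected G → GirthAtLeast G (5 * ℓ + 1) →
    (∀ v → 2 ≤ deg G v) → (∃ λ v → 3 ≤ deg G v) →
    Σ ℕ λ k → (ℓ + 1 ≤ k) × Σ (Fin (suc k) → Fin (n G)) (SuspendedPath G k)
lemma22 ℓ G (ρ , euler) 2-conn girth δ≥2 (z , 3≤deg) =
  [ id , ⊥-elim ∘ euler⇒¬nextBranchesWithin ρ δ≥2 2-conn ℓ euler girth 3≤deg ]′ (long-or-short ρ δ≥2 2-conn ℓ)
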